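{- Any two parameters in $\{\mathrm{d\text{ - }nw},\mathrm{d\text{ - }lnlcw},\mathrm{d\text{ - }lcw},\mathrm{d\text{ - }lrw}\}$ are equivalent: for any two of them $\alpha,\beta$ there exist functions $f_1,f_2:\mathbb N\to\mathbb N$ such that for every digraph $G$, $\alpha(G)\le f_1(\beta(G))$ and $\beta(G)\le f_2(\alpha(G))$.
   Context: Digraphs $G=(V,E)$ are finite with $E\subseteq\{(u,v):u\ne v\}$. A layout is a bijection $\varphi:V\to\{1,\dots,|V|\}$; $L(i,\varphi)=\{u:\varphi(u)\le i\}$, $R(i,\varphi)=\{u:\varphi(u)>i\}$. With $N_i(u)=(\{v\in R(i,\varphi):(u,v)\in E\},\{v\in R(i,\varphi):(v,u)\in E\})$, $\mathrm{d\text{ - }nw}(G)=\min_\varphi\max_i|\{N_i(u):u\in L(i,\varphi)\}|$. $\mathrm{d\text{ - }lnlcw}(G)$ is the least $k$ such that $G$ (under some labeling) is built from labeled digraphs with labels in $[k]$ by: $\bullet_a$ (a vertex labeled $a$); $H\otimes_{(\overrightarrow S,\overleftarrow S)}\bullet_a$ ($\overrightarrow S,\overleftarrow S\subseteq[k]^2$): add a new vertex $v$ labeled $a$ plus arcs $(u,v)$ for $u$ in $H$ of label $b$ with $(b,a)\in\overrightarrow S$ and arcs $(v,u)$ for $u$ in $H$ of label $b$ with $(b,a)\in\overleftarrow S$; $\circ_R$ ($R:[k]\to[k]$, relabel $a$ to $R(a)$). $\mathrm{d\text{ - }lcw}(G)$ is the least number of labels to build $G$ with $\bullet_a$, $H\oplus\bullet_a$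 (add a new isolated vertex labeled $a$), $\alpha_{a,b}$ ($a\ne b$; add arcs from all label-$a$ to all label-$b$ vertices), $\rho_{a\to b}$ (relabel). $\mathrm{d\text{ - }lrw}(G)$: minimum over pairs $(T,f)$, $T$ a caterpillar (a path with pendant vertices), $f$ a bijection from $V$ to the leaves of $T$, of the maximum over edges $e$ of $T$ (splitting $V$ into $A_e,B_e$) of the $GF(4)$-rank of the $A_e\times B_e$ matrix with entry $0$ (no arc between $x,y$), $\omega$ (only $(x,y)\in E$), $\omega^2$ (only $(y,x)\in E$), $1$ (both), where $GF(4)=\{0,1,\omega,\omega^2\}$. -}

module Defs where

open import Data.Nat using (ℕ; zero; suc; _≤_; _<_; _<ᵇ_)
open import Data.Fin using (Fin; zero; suc; toℕ)
open import Data.Fin.Permutation using (Permutation′; _⟨$⟩ʳ_)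
open import Data.Bool using (Bool; true; false; _∧_; _∨_; not; if_then_else_)
import Data.Bool as B
import Data.Fin as F
open import Data.Vec using (Vec; tabulate)
import Data.Vec.Properties as VP
open import Data.List using (List; length; filter; map; deduplicate)
open import Data.List.Base using (allFin)
open import Data.Product using (Σ; ∃; _×_; _,_)
open import Relation.Nullary using (Dec; ¬_; yes; no)
open import Relation.Nullary.Decidable using (⌊_⌋; _×-dec_)
open import Relation.Unary using (Pred)
open import Relation.Binary.PropositionalEquality using (_≡_; _≢_; refl; cong₂)
open import Relation.Binary.Definitions using (DecidableEquality)
import Data.Product.Properties as PP

record Digraph : Set where
  field
    n      : ℕ
    arc    : Fin n → Fin n → Bool
    irrefl : ∀ u → arc u u ≡ false
open Digraph public

_≅_ : (G : Digraph) → (Fin (n G) → Fin (n G) → Bool) → Set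
G ≅ H = Σ (Permutation′ (n G)) λ π →
          ∀ u v → arc G u v ≡ H (π ⟨$⟩ʳ u) (π ⟨$⟩ʳ v)

φ : ∀ {m} → Permutation′ m → Fin m → ℕ
φ π u = suc (toℕ (π ⟨$⟩ʳ u))

inL : ∀ {m} → Permutation′ m → ℕ → Fin m → Bool
inL π i u = φ π u <ᵇ suc i

inR : ∀ {m} → Permutation′ m → ℕ → Fin m → Bool
inR π i u = not (inL π i u)

-- N_i(u) = (out-neighbours of u in R , in-neighbours of u in R),
-- each as a characteristic vector over V.
Nbh : (G : Digraph) → Permutation′ (n G) → ℕ → Fin (n G) →
      Vec Bool (n G) × Vec Bool (n G)
Nbh G π i u = tabulate (λ v → inR π i v ∧ arc G u v)
            , tabulate (λ v → inR π i v ∧ arc G v u)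

decNbh : ∀ {m} → DecidableEquality (Vec Bool m × Vec Bool m)
decNbh (a , b) (c , d) with VP.≡-dec B._≟_ a c | VP.≡-dec B._≟_ b d
... | yes refl | yes refl = yes refl
... | no p     | _        = no λ { refl → p refl }
... | yes _    | no q     = no λ { refl → q refl }

Lset : ∀ {m} → Permutation′ m → ℕ → List (Fin m)
Lset π i = filter (λ u → inL π i u B.≟ true) (allFin _)

nbhCount : (G : Digraph) → Permutation′ (n G) → ℕ → ℕ
nbhCount G π i = length (deduplicate decNbh (map (Nbh G π i) (Lset π i)))

NWle : Digraph → ℕ → Set
NWle G k = Σ (Permutation′ (n G)) λ π →
             ∀ i → 1 ≤ i → i ≤ n G → nbhCount G π i ≤ k

-- The vertex created last is `zero`, older vertices are shifted by `suc`.

data NLC (k : ℕ) : ℕ → Set where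
  vtx : Fin k → NLC k 1
  add : ∀ {m} → NLC k m → (Sout Sin : Fin k → Fin k → Bool) → Fin k →
        NLC k (suc m)
  rel : ∀ {m} → NLC k m → (Fin k → Fin k) → NLC k m

nlcLab : ∀ {k m} → NLC k m → Fin m → Fin k
nlcLab (vtx a)         zero    = a
nlcLab (add e So Si a) zero    = a
nlcLab (add e So Si a) (suc u) = nlcLab e u
nlcLab (rel e R)       u       = R (nlcLab e u)

nlcArc : ∀ {k m} → NLC k m → Fin m → Fin m → Bool
nlcArc (vtx a)         _       _       = false
nlcArc (add e So Si a) zero    zero    = false
nlcArc (add e So Si a) (suc u) zero    = So (nlcLab e u) a
nlcArc (add e So Si a) zero    (suc u) = Si (nlcLab e u) a
nlcArc (add e So Si a) (suc u) (suc v) = nlcArc e u v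
nlcArc (rel e R)       u       v       = nlcArc e u v

LNLCle : Digraph → ℕ → Set
LNLCle G k = Σ (NLC k (n G)) λ e → G ≅ nlcArc e

data LCW (k : ℕ) : ℕ → Set where
  vtx : Fin k → LCW k 1
  add : ∀ {m} → LCW k m → Fin k → LCW k (suc m)
  α   : ∀ {m} → LCW k m → (a b : Fin k) → a ≢ b → LCW k m
  ρ   : ∀ {m} → LCW k m → (a b : Fin k) → LCW k m

eqᵇ : ∀ {k} → Fin k → Fin k → Bool
eqᵇ a b = ⌊ a F.≟ b ⌋

lcwLab : ∀ {k m} → LCW k m → Fin m → Fin k
lcwLab (vtx a)     _       = a
lcwLab (add e a)   zero    = a
lcwLab (add e a)   (suc u) = lcwLab e u
lcwLab (α e a b _) u       = lcwLab e u
lcwLab (ρ e a b)   u       = if eqᵇ (lcwLab e u) a then b else lcwLab e u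

lcwArc : ∀ {k m} → LCW k m → Fin m → Fin m → Bool
lcwArc (vtx a)     _       _       = false
lcwArc (add e a)   zero    _       = false
lcwArc (add e a)   (suc u) zero    = false
lcwArc (add e a)   (suc u) (suc v) = lcwArc e u v
lcwArc (α e a b _) u       v       =
  lcwArc e u v ∨ (eqᵇ (lcwLab e u) a ∧ eqᵇ (lcwLab e v) b)
lcwArc (ρ e a b)   u       v       = lcwArc e u v

LCWle : Digraph → ℕ → Set
LCWle G k = Σ (LCW k (n G)) λ e → G ≅ lcwArc e

-- GF(4) = {0, 1, ω, ω²} with ω² = ω + 1.

data GF4 : Set where
  𝟘 𝟙 ω ω² : GF4

_⊕_ : GF4 → GF4 → GF4
𝟘  ⊕ y  = y
x  ⊕ 𝟘  = x
𝟙  ⊕ 𝟙  = 𝟘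
𝟙  ⊕ ω  = ω²
𝟙  ⊕ ω² = ω
ω  ⊕ 𝟙  = ω²
ω  ⊕ ω  = 𝟘
ω  ⊕ ω² = 𝟙
ω² ⊕ 𝟙  = ω
ω² ⊕ ω  = 𝟙
ω² ⊕ ω² = 𝟘

_⊗_ : GF4 → GF4 → GF4
𝟘  ⊗ _  = 𝟘
_  ⊗ 𝟘  = 𝟘
𝟙  ⊗ y  = y
x  ⊗ 𝟙  = x
ω  ⊗ ω  = ω²
ω  ⊗ ω² = 𝟙
ω² ⊗ ω  = 𝟙
ω² ⊗ ω² = ω

sumGF4 : ∀ {m} → (Fin m → GF4) → GF4
sumGF4 {zero}  f = 𝟘
sumGF4 {suc m} f = f zero ⊕ sumGF4 (λ j → f (suc j))

entry : (G : Digraph) → Fin (n G) → Fin (n G) → GF4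
entry G x y with arc G x y | arc G y x
... | false | false = 𝟘
... | true  | false = ω
... | false | true  = ω²
... | true  | true  = 𝟙

-- The GF(4)-rank of the A × B submatrix of `entry G` is ≤ r:
-- every r+1 rows (indexed by vertices of A) are linearly dependent.
RankLe : (G : Digraph) → (A B : Fin (n G) → Bool) → ℕ → Set
RankLe G A B r =
  (rows : Fin (suc r) → Fin (n G)) → (∀ j → A (rows j) ≡ true) →
  Σ (Fin (suc r) → GF4) λ c →
    (Σ (Fin (suc r)) λ j → c j ≢ 𝟘) ×
    (∀ y → B y ≡ true → sumGF4 (λ j → c j ⊗ entry G (rows j) y) ≡ 𝟘)

-- Caterpillar decompositions, described by the order σ in which the leaves
-- occur along the spine: spine edges induce prefix cuts, pendant edges
-- induce singleton cuts.

LRWle : Digraph → ℕ → Set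
LRWle G k = Σ (Permutation′ (n G)) λ σ →
    (∀ j → RankLe G (inL σ j) (inR σ j) k)
  × (∀ v → RankLe G (λ u → eqᵇ u v) (λ u → not (eqᵇ u v)) k)

data Param : Set where
  d-nw d-lnlcw d-lcw d-lrw : Param

WidthLe : Param → Digraph → ℕ → Set
WidthLe d-nw    = NWle
WidthLe d-lnlcw = LNLCle
WidthLe d-lcw   = LCWle
WidthLe d-lrw   = LRWle

WidthIs : Param → Digraph → ℕ → Set
WidthIs p G k = WidthLe p G k × (∀ j → WidthLe p G j → k ≤ j)

-- Every parameter is compared with the directed neighbourhood width d-nw:
--   d-nw ≤ d-lcw            (lcw→nw: old vertices with equal labels stay twins)
--   d-lcw ≤ 2·d-lnlcw + 1   (nlc→lcw: each NLC operation is simulated by α's and ρ's)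
--   d-lnlcw ≤ d-nw + 1      (nw→nlc: insert the vertices in layout order,
--                            labelled by their neighbourhood classes)
--   d-lrw ≤ d-nw + 1 and d-nw ≤ 4 ^ d-lrw   (nw→lrw, lrw→nw)
-- The rank bounds rest on linear algebra over GF(4), developed first for an
-- abstract matrix: rows falling into r classes of equal rows have rank ≤ r
-- (pigeonhole), and rank ≤ r allows at most 4^r distinct rows (Gaussian
-- elimination).  Across a cut, two vertices have equal neighbourhoods iff
-- they have the same arcs to the other side iff their GF(4) rows agree;
-- bounding the number of such classes bounds nbhCount (nbhCount≤).
-- The theorem composes the bounds through d-nw; the only extra observation
-- is that an expression always builds at least one vertex.

module Submission where

open import Defs
open import Data.Nat using (ℕ; zero; suc; _+_; _≤_; _<_; _^_; _∸_; z≤n; s≤s)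
open import Data.Nat.Properties
  using (m^n>0; ≤-refl; ≤-trans; <⇒≤; <⇒≢; <⇒≱; ≰⇒>; ≮⇒≥; <ᵇ⇒<; <⇒<ᵇ; _≤?_; +-comm;
         m≤m+n; n≤1+n; ≤-pred; ≤-reflexive; m∸n≤m; m∸[m∸n]≡n;
         m∸n≢0⇒n<m; m≤o∸n⇒m+n≤o; m+n≤o⇒m≤o∸n)
open import Data.Fin as F using (Fin; zero; suc; toℕ)
import Data.Fin.Properties as FP
open import Data.Fin.Permutation using (Permutation′; _⟨$⟩ʳ_; _⟨$⟩ˡ_; inverseˡ; inverseʳ; _∘ₚ_)
import Data.Fin.Permutation as Perm
open import Data.Bool using (Bool; true; false; _∧_; _∨_; not; if_then_else_)
import Data.Bool as Bool
open import Data.Bool.Properties using (T-≡; ∨-assoc; ∨-identityʳ; ∧-identityʳ; ∧-zeroʳ)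
open import Data.Vec using (Vec; tabulate)
import Data.Vec as Vec
import Data.Vec.Properties as VecP
open import Data.List using (List; []; _∷_; length; map; lookup; deduplicate; allFin)
open import Data.List.Membership.Propositional using (_∈_)
open import Data.List.Membership.Propositional.Properties
  using (∈-lookup; ∈-map⁺; ∈-map⁻; ∈-deduplicate⁺; ∈-deduplicate⁻; ∈-filter⁺; ∈-filter⁻; ∈-allFin)
open import Data.List.Relation.Unary.Any using (here; there)
import Data.List.Relation.Unary.All as All
open import Data.List.Relation.Unary.AllPairs using (_∷_)
open import Data.List.Relation.Unary.Unique.Propositional using (Unique)
open import Data.List.Relation.Unary.Unique.DecPropositional.Properties using (deduplicate-!)
open import Data.Product using (Σ; _×_; _,_; proj₁; proj₂)
open import Data.Sum using (_⊎_; inj₁; inj₂)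
open import Data.Empty using (⊥; ⊥-elim)
open import Function.Bundles using (Equivalence)
open import Relation.Nullary using (Dec; yes; no)
open import Relation.Nullary.Decidable using (from-yes; map′; _⊎-dec_; _→-dec_; _×-dec_; ¬?)
open import Relation.Binary.Definitions using (DecidableEquality)
open import Relation.Binary.PropositionalEquality

-- The field GF(4).  Its laws quantify over a four-element set, so each is
-- decided by evaluating it on all elements (from-yes).

toFin : GF4 → Fin 4
toFin 𝟘  = zero
toFin 𝟙  = suc zero
toFin ω  = suc (suc zero)
toFin ω² = suc (suc (suc zero))

fromFin : Fin 4 → GF4
fromFin zero                   = 𝟘
fromFin (suc zero)             = 𝟙
fromFin (suc (suc zero))       = ω
fromFin (suc (suc (suc zero))) = ω²

fromFin-toFin : ∀ x → fromFin (toFin x) ≡ x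
fromFin-toFin 𝟘  = refl
fromFin-toFin 𝟙  = refl
fromFin-toFin ω  = refl
fromFin-toFin ω² = refl

toFin-injective : ∀ {x y} → toFin x ≡ toFin y → x ≡ y
toFin-injective {x} {y} eq =
  trans (sym (fromFin-toFin x)) (trans (cong fromFin eq) (fromFin-toFin y))

infix 4 _≟𝔽_
_≟𝔽_ : DecidableEquality GF4
x ≟𝔽 y = map′ toFin-injective (cong toFin) (toFin x F.≟ toFin y)

all𝔽? : {P : GF4 → Set} → (∀ x → Dec (P x)) → Dec (∀ x → P x)
all𝔽? {P} P? = map′ (λ h x → subst P (fromFin-toFin x) (h (toFin x)))
                    (λ h i → h (fromFin i)) (FP.all? (λ i → P? (fromFin i)))

-- The multiplicative inverse (with 𝟘⁻¹ = 𝟘).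
_⁻¹ : GF4 → GF4
𝟘 ⁻¹  = 𝟘
𝟙 ⁻¹  = 𝟙
ω ⁻¹  = ω²
ω² ⁻¹ = ω

⊕-identityʳ : ∀ x → x ⊕ 𝟘 ≡ x
⊕-identityʳ = from-yes (all𝔽? λ x → x ⊕ 𝟘 ≟𝔽 x)

⊕-self : ∀ x → x ⊕ x ≡ 𝟘
⊕-self = from-yes (all𝔽? λ x → x ⊕ x ≟𝔽 𝟘)

⊕-cancelʳ : ∀ x y → (x ⊕ y) ⊕ y ≡ x
⊕-cancelʳ = from-yes (all𝔽? λ x → all𝔽? λ y → (x ⊕ y) ⊕ y ≟𝔽 x)

⊕≡𝟘⇒≡ : ∀ x y → x ⊕ y ≡ 𝟘 → x ≡ y
⊕≡𝟘⇒≡ = from-yes (all𝔽? λ x → all𝔽? λ y → (x ⊕ y ≟𝔽 𝟘) →-dec (x ≟𝔽 y))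

⊕-interchange : ∀ x y z u → (x ⊕ y) ⊕ (z ⊕ u) ≡ (x ⊕ z) ⊕ (y ⊕ u)
⊕-interchange = from-yes (all𝔽? λ x → all𝔽? λ y → all𝔽? λ z → all𝔽? λ u →
                            (x ⊕ y) ⊕ (z ⊕ u) ≟𝔽 (x ⊕ z) ⊕ (y ⊕ u))

⊗-assoc : ∀ x y z → (x ⊗ y) ⊗ z ≡ x ⊗ (y ⊗ z)
⊗-assoc = from-yes (all𝔽? λ x → all𝔽? λ y → all𝔽? λ z → (x ⊗ y) ⊗ z ≟𝔽 x ⊗ (y ⊗ z))

⊗-distribˡ : ∀ x y z → x ⊗ (y ⊕ z) ≡ (x ⊗ y) ⊕ (x ⊗ z)
⊗-distribˡ = from-yes (all𝔽? λ x → all𝔽? λ y → all𝔽? λ z →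
                         x ⊗ (y ⊕ z) ≟𝔽 (x ⊗ y) ⊕ (x ⊗ z))

⊗-distribʳ : ∀ x y z → (x ⊕ y) ⊗ z ≡ (x ⊗ z) ⊕ (y ⊗ z)
⊗-distribʳ = from-yes (all𝔽? λ x → all𝔽? λ y → all𝔽? λ z →
                         (x ⊕ y) ⊗ z ≟𝔽 (x ⊗ z) ⊕ (y ⊗ z))

noZeroDivisors : ∀ x y → x ⊗ y ≡ 𝟘 → x ≡ 𝟘 ⊎ y ≡ 𝟘
noZeroDivisors = from-yes (all𝔽? λ x → all𝔽? λ y →
                             (x ⊗ y ≟𝔽 𝟘) →-dec ((x ≟𝔽 𝟘) ⊎-dec (y ≟𝔽 𝟘)))

⊗-inverse : ∀ a → a ≢ 𝟘 → a ⊗ (a ⁻¹) ≡ 𝟙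
⊗-inverse = from-yes (all𝔽? λ a → ¬? (a ≟𝔽 𝟘) →-dec (a ⊗ (a ⁻¹) ≟𝔽 𝟙))

⊗-identityˡ : ∀ x → 𝟙 ⊗ x ≡ x
⊗-identityˡ = from-yes (all𝔽? λ x → 𝟙 ⊗ x ≟𝔽 x)

pivot-cancel : ∀ c a b → a ≢ 𝟘 → (c ⊗ a) ⊗ ((a ⁻¹) ⊗ b) ≡ c ⊗ b
pivot-cancel c a b a≢𝟘 = begin
  (c ⊗ a) ⊗ ((a ⁻¹) ⊗ b)  ≡⟨ ⊗-assoc c a _ ⟩
  c ⊗ (a ⊗ ((a ⁻¹) ⊗ b))  ≡⟨ cong (c ⊗_) (sym (⊗-assoc a (a ⁻¹) b)) ⟩
  c ⊗ ((a ⊗ (a ⁻¹)) ⊗ b)  ≡⟨ cong (λ e → c ⊗ (e ⊗ b)) (⊗-inverse a a≢𝟘) ⟩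
  c ⊗ (𝟙 ⊗ b)            ≡⟨ cong (c ⊗_) (⊗-identityˡ b) ⟩
  c ⊗ b                  ∎
  where open ≡-Reasoning

sum-cong : ∀ {m} {u v : Fin m → GF4} → (∀ j → u j ≡ v j) → sumGF4 u ≡ sumGF4 v
sum-cong {zero}  eq = refl
sum-cong {suc m} eq = cong₂ _⊕_ (eq zero) (sum-cong (λ j → eq (suc j)))

sum-zero : ∀ {m} (v : Fin m → GF4) → (∀ j → v j ≡ 𝟘) → sumGF4 v ≡ 𝟘
sum-zero {zero}  v eq = refl
sum-zero {suc m} v eq rewrite eq zero = sum-zero (λ j → v (suc j)) (λ j → eq (suc j))

sum-⊕ : ∀ {m} (u v : Fin m → GF4) →
        sumGF4 (λ j → u j ⊕ v j) ≡ sumGF4 u ⊕ sumGF4 v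
sum-⊕ {zero}  u v = refl
sum-⊕ {suc m} u v rewrite sum-⊕ (λ j → u (suc j)) (λ j → v (suc j)) =
  ⊕-interchange (u zero) (v zero) _ _

sum-⊗ʳ : ∀ {m} (v : Fin m → GF4) z → sumGF4 (λ j → v j ⊗ z) ≡ sumGF4 v ⊗ z
sum-⊗ʳ {zero}  v z = refl
sum-⊗ʳ {suc m} v z rewrite sum-⊗ʳ (λ j → v (suc j)) z =
  sym (⊗-distribʳ (v zero) _ z)

sum-linear : ∀ {m} (c u v : Fin m → GF4) z →
  sumGF4 (λ j → c j ⊗ (u j ⊕ (v j ⊗ z)))
    ≡ sumGF4 (λ j → c j ⊗ u j) ⊕ (sumGF4 (λ j → c j ⊗ v j) ⊗ z)
sum-linear c u v z = begin
  sumGF4 (λ j → c j ⊗ (u j ⊕ (v j ⊗ z)))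
    ≡⟨ sum-cong (λ j → trans (⊗-distribˡ (c j) _ _)
                             (cong ((c j ⊗ u j) ⊕_) (sym (⊗-assoc (c j) (v j) z)))) ⟩
  sumGF4 (λ j → (c j ⊗ u j) ⊕ ((c j ⊗ v j) ⊗ z))
    ≡⟨ sum-⊕ (λ j → c j ⊗ u j) (λ j → (c j ⊗ v j) ⊗ z) ⟩
  sumGF4 (λ j → c j ⊗ u j) ⊕ sumGF4 (λ j → (c j ⊗ v j) ⊗ z)
    ≡⟨ cong (sumGF4 (λ j → c j ⊗ u j) ⊕_) (sum-⊗ʳ (λ j → c j ⊗ v j) z) ⟩
  sumGF4 (λ j → c j ⊗ u j) ⊕ (sumGF4 (λ j → c j ⊗ v j) ⊗ z)  ∎
  where open ≡-Reasoning

δ : ∀ {m} → Fin m → Fin m → GF4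
δ zero    zero    = 𝟙
δ zero    (suc _) = 𝟘
δ (suc _) zero    = 𝟘
δ (suc a) (suc j) = δ a j

δ-diag : ∀ {m} (a : Fin m) → δ a a ≡ 𝟙
δ-diag zero    = refl
δ-diag (suc a) = δ-diag a

δ-off : ∀ {m} {a b : Fin m} → a ≢ b → δ a b ≡ 𝟘
δ-off {a = zero}  {zero}  a≢b = ⊥-elim (a≢b refl)
δ-off {a = zero}  {suc b} a≢b = refl
δ-off {a = suc a} {zero}  a≢b = refl
δ-off {a = suc a} {suc b} a≢b = δ-off (λ eq → a≢b (cong suc eq))

sum-δ : ∀ {m} (a : Fin m) (v : Fin m → GF4) → sumGF4 (λ j → δ a j ⊗ v j) ≡ v a
sum-δ zero    v = trans (cong₂ _⊕_ (⊗-identityˡ (v zero))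
                                    (sum-zero (λ j → 𝟘 ⊗ v (suc j)) (λ _ → refl)))
                        (⊕-identityʳ (v zero))
sum-δ (suc a) v = sum-δ a (λ j → v (suc j))

Agree : ∀ {m N} → (Fin N → Bool) → (Fin m → Fin N → GF4) → Fin m → Fin m → Set
Agree B f i i' = ∀ y → B y ≡ true → f i y ≡ f i' y

module Matrix {m N : ℕ} (A : Fin m → Bool) (B : Fin N → Bool) where

  Dependent : (Fin m → Fin N → GF4) → ℕ → Set
  Dependent f r =
    (rows : Fin (suc r) → Fin m) → (∀ j → A (rows j) ≡ true) →
    Σ (Fin (suc r) → GF4) λ c →
      (Σ (Fin (suc r)) λ j → c j ≢ 𝟘) ×
      (∀ y → B y ≡ true → sumGF4 (λ j → c j ⊗ f (rows j) y) ≡ 𝟘)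

  RowClasses : (Fin m → Fin N → GF4) → ℕ → Set
  RowClasses f r = Σ (Fin m → Fin r) λ h →
    ∀ i i' → A i ≡ true → A i' ≡ true → h i ≡ h i' → Agree B f i i'

  -- Among r+1 rows drawn from r classes two agree, and their sum vanishes.
  classes⇒dependent : ∀ {f r} → RowClasses f r → Dependent f r
  classes⇒dependent {f} {r} (h , sameClass) rows inA
    with a , b , a<b , ha≡hb ← FP.pigeonhole ≤-refl (λ j → h (rows j)) =
    c , (a , c[a]≢𝟘) , sum≡𝟘
    where
    open ≡-Reasoning
    b≢a : b ≢ a
    b≢a b≡a = FP.<-irrefl (sym b≡a) a<b
    c : Fin (suc r) → GF4
    c j = δ a j ⊕ δ b j
    c[a]≢𝟘 : c a ≢ 𝟘
    c[a]≢𝟘 eq with () ← trans (sym (cong₂ _⊕_ (δ-diag a) (δ-off b≢a))) eq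
    sum≡𝟘 : ∀ y → B y ≡ true → sumGF4 (λ j → c j ⊗ f (rows j) y) ≡ 𝟘
    sum≡𝟘 y y∈B = begin
      sumGF4 (λ j → c j ⊗ v j)
        ≡⟨ sum-cong (λ j → ⊗-distribʳ (δ a j) (δ b j) (v j)) ⟩
      sumGF4 (λ j → (δ a j ⊗ v j) ⊕ (δ b j ⊗ v j))
        ≡⟨ sum-⊕ (λ j → δ a j ⊗ v j) (λ j → δ b j ⊗ v j) ⟩
      sumGF4 (λ j → δ a j ⊗ v j) ⊕ sumGF4 (λ j → δ b j ⊗ v j)
        ≡⟨ cong₂ _⊕_ (sum-δ a v) (sum-δ b v) ⟩
      v a ⊕ v b
        ≡⟨ cong (_⊕ v b) (sameClass _ _ (inA a) (inA b) ha≡hb y y∈B) ⟩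
      v b ⊕ v b
        ≡⟨ ⊕-self (v b) ⟩
      𝟘 ∎
      where
      v : Fin (suc r) → GF4
      v j = f (rows j) y

  AllZero : (Fin m → Fin N → GF4) → Set
  AllZero f = ∀ i y → A i ≡ true → B y ≡ true → f i y ≡ 𝟘

  zero⇒classes : ∀ {f r} → Fin r → AllZero f → RowClasses f r
  zero⇒classes c₀ z =
    (λ _ → c₀) , λ i i' i∈A i'∈A _ y y∈B → trans (z i y i∈A y∈B) (sym (z i' y i'∈A y∈B))

  Pivot : (Fin m → Fin N → GF4) → Set
  Pivot f = Σ (Fin m) λ i → Σ (Fin N) λ y →
              (A i ≡ true) × (B y ≡ true) × (f i y ≢ 𝟘)

  pivot? : ∀ f → Pivot f ⊎ AllZero f
  pivot? f with FP.any? (λ i → FP.any? (λ y →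
                  (A i Bool.≟ true) ×-dec (B y Bool.≟ true) ×-dec ¬? (f i y ≟𝔽 𝟘)))
  ... | yes p    = inj₁ p
  ... | no none = inj₂ allZero
    where
    allZero : AllZero f
    allZero i y i∈A y∈B with f i y ≟𝔽 𝟘
    ... | yes z   = z
    ... | no nz  = ⊥-elim (none (i , y , i∈A , y∈B , nz))

  -- One step of Gaussian elimination with pivot a = f i₀ y₀: subtracting
  -- from each row i the multiple (f i y₀ / a) of row i₀ kills column y₀
  -- and row i₀, and lowers the rank bound by one.
  module Elimination (f : Fin m → Fin N → GF4) (i₀ : Fin m) (y₀ : Fin N)
                     (i₀∈A : A i₀ ≡ true) (y₀∈B : B y₀ ≡ true)
                     (a≢𝟘 : f i₀ y₀ ≢ 𝟘) where

    a : GF4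
    a = f i₀ y₀

    t : Fin m → Fin N → GF4
    t i y = f i y₀ ⊗ ((a ⁻¹) ⊗ f i₀ y)

    reduced : Fin m → Fin N → GF4
    reduced i y = f i y ⊕ t i y

    -- (char 2: subtracting is adding)
    restore : ∀ i y → f i y ≡ reduced i y ⊕ t i y
    restore i y = sym (⊕-cancelʳ (f i y) (t i y))

    -- Given r+1 rows, add row i₀ and use a dependence among these r+2
    -- rows of f: its restriction to the r+1 given rows is a dependence of
    -- the reduced rows, and it is nontrivial because a ≢ 𝟘.
    reduced-dependent : ∀ {r} → Dependent f (suc r) → Dependent reduced r
    reduced-dependent dep rows inA
      with c , (j₀ , c[j₀]≢𝟘) , sum≡𝟘 ← dep (λ { zero → i₀ ; (suc j) → rows j })
                                        (λ { zero → i₀∈A ; (suc j) → inA j }) =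
      (λ j → c (suc j)) , nontrivial , sum≡𝟘′
      where
      open ≡-Reasoning
      S : Fin N → GF4
      S y = sumGF4 (λ j → c (suc j) ⊗ f (rows j) y)
      S-pivot : ∀ y → B y ≡ true → c zero ⊗ f i₀ y ≡ S y
      S-pivot y y∈B = ⊕≡𝟘⇒≡ _ _ (sum≡𝟘 y y∈B)
      nontrivial : Σ (Fin (suc _)) λ j → c (suc j) ≢ 𝟘
      nontrivial with FP.any? (λ j → ¬? (c (suc j) ≟𝔽 𝟘))
      ... | yes found = found
      ... | no none   = ⊥-elim (c-zero j₀ c[j₀]≢𝟘)
        where
        c-tail : ∀ j → c (suc j) ≡ 𝟘
        c-tail j with c (suc j) ≟𝔽 𝟘
        ... | yes z  = z
        ... | no nz = ⊥-elim (none (j , nz))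
        c-head : c zero ≡ 𝟘
        c-head with noZeroDivisors (c zero) a
                      (trans (S-pivot y₀ y₀∈B)
                             (sum-zero _ (λ j → cong (_⊗ f (rows j) y₀) (c-tail j))))
        ... | inj₁ z   = z
        ... | inj₂ a≡𝟘 = ⊥-elim (a≢𝟘 a≡𝟘)
        c-zero : ∀ j → c j ≢ 𝟘 → ⊥
        c-zero zero    nz = nz c-head
        c-zero (suc j) nz = nz (c-tail j)
      sum≡𝟘′ : ∀ y → B y ≡ true → sumGF4 (λ j → c (suc j) ⊗ reduced (rows j) y) ≡ 𝟘
      sum≡𝟘′ y y∈B = begin
        sumGF4 (λ j → c (suc j) ⊗ (f (rows j) y ⊕ (f (rows j) y₀ ⊗ z)))
          ≡⟨ sum-linear (λ j → c (suc j)) (λ j → f (rows j) y) (λ j → f (rows j) y₀) z ⟩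
        S y ⊕ (S y₀ ⊗ z)
          ≡⟨ cong₂ (λ p q → p ⊕ (q ⊗ z)) (sym (S-pivot y y∈B)) (sym (S-pivot y₀ y₀∈B)) ⟩
        (c zero ⊗ f i₀ y) ⊕ ((c zero ⊗ a) ⊗ z)
          ≡⟨ cong ((c zero ⊗ f i₀ y) ⊕_) (pivot-cancel (c zero) a (f i₀ y) a≢𝟘) ⟩
        (c zero ⊗ f i₀ y) ⊕ (c zero ⊗ f i₀ y)
          ≡⟨ ⊕-self (c zero ⊗ f i₀ y) ⟩
        𝟘 ∎
        where
        z : GF4
        z = (a ⁻¹) ⊗ f i₀ y

  -- Rank ≤ r gives at most 4^r distinct rows: by induction on r, a row is
  -- determined by its pivot-column entry and its reduced row.
  dependent⇒classes : ∀ {f} r → Dependent f r → RowClasses f (4 ^ r)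
  dependent⇒classes {f} zero dep = zero⇒classes zero vanish
    where
    vanish : AllZero f
    vanish i y i∈A y∈B
      with c , (zero , c₀≢𝟘) , sum≡𝟘 ← dep (λ _ → i) (λ _ → i∈A)
      with noZeroDivisors (c zero) (f i y) (trans (sym (⊕-identityʳ _)) (sum≡𝟘 y y∈B))
    ... | inj₁ c₀≡𝟘 = ⊥-elim (c₀≢𝟘 c₀≡𝟘)
    ... | inj₂ z    = z
  dependent⇒classes {f} (suc r) dep with pivot? f
  ... | inj₂ allZero = zero⇒classes (F.fromℕ< (m^n>0 4 (suc r))) allZero
  ... | inj₁ (i₀ , y₀ , i₀∈A , y₀∈B , a≢𝟘) = h , agree
    where
    open Elimination f i₀ y₀ i₀∈A y₀∈B a≢𝟘
    open ≡-Reasoning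
    reducedClasses : RowClasses reduced (4 ^ r)
    reducedClasses = dependent⇒classes r (reduced-dependent dep)
    h : Fin m → Fin (4 ^ suc r)
    h i = F.combine (toFin (f i y₀)) (proj₁ reducedClasses i)
    agree : ∀ i i' → A i ≡ true → A i' ≡ true → h i ≡ h i' → Agree B f i i'
    agree i i' i∈A i'∈A hi≡hi' y y∈B = begin
      f i y                  ≡⟨ restore i y ⟩
      reduced i y ⊕ t i y    ≡⟨ cong₂ _⊕_ (proj₂ reducedClasses i i' i∈A i'∈A same-reduced y y∈B)
                                          (cong (_⊗ ((a ⁻¹) ⊗ f i₀ y)) same-pivot-entry) ⟩
      reduced i' y ⊕ t i' y  ≡⟨ restore i' y ⟨
      f i' y                 ∎
      where
      same-pivot-entry : f i y₀ ≡ f i' y₀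
      same-pivot-entry =
        toFin-injective (FP.combine-injectiveˡ (toFin (f i y₀)) _ (toFin (f i' y₀)) _ hi≡hi')
      same-reduced : proj₁ reducedClasses i ≡ proj₁ reducedClasses i'
      same-reduced = FP.combine-injectiveʳ (toFin (f i y₀)) _ (toFin (f i' y₀)) _ hi≡hi'

unique-lookup-injective : ∀ {X : Set} {xs : List X} → Unique xs →
                          ∀ i j → lookup xs i ≡ lookup xs j → i ≡ j
unique-lookup-injective (_  ∷ _) zero    zero    _  = refl
unique-lookup-injective (x∉ ∷ _) zero    (suc j) eq = ⊥-elim (All.lookup x∉ (∈-lookup j) eq)
unique-lookup-injective (x∉ ∷ _) (suc i) zero    eq = ⊥-elim (All.lookup x∉ (∈-lookup i) (sym eq))
unique-lookup-injective (_  ∷ u) (suc i) (suc j) eq = cong suc (unique-lookup-injective u i j eq)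

unique-length≤ : ∀ {X : Set} {xs : List X} {k} → Unique xs →
  (g : ∀ {x} → x ∈ xs → Fin k) →
  (∀ {x y} (p : x ∈ xs) (q : y ∈ xs) → g p ≡ g q → x ≡ y) →
  length xs ≤ k
unique-length≤ {xs = xs} {k} unique g g-injective with length xs ≤? k
... | yes ≤k = ≤k
... | no  >k with i , j , i<j , gi≡gj ← FP.pigeonhole (≰⇒> >k) (λ i → g (∈-lookup i)) =
  ⊥-elim (FP.<-irrefl (unique-lookup-injective unique i j
                         (g-injective (∈-lookup i) (∈-lookup j) gi≡gj)) i<j)

clamp : (k : ℕ) → ℕ → Fin (suc k)
clamp zero    _       = zero
clamp (suc k) zero    = zero
clamp (suc k) (suc p) = suc (clamp k p)

toℕ-clamp : ∀ k p → p ≤ k → toℕ (clamp k p) ≡ p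
toℕ-clamp zero    zero    _         = refl
toℕ-clamp (suc k) zero    _         = refl
toℕ-clamp (suc k) (suc p) (s≤s p≤k) = cong suc (toℕ-clamp k p p≤k)

module Positions {X : Set} (_≟_ : DecidableEquality X) (default : X) where

  -- the position of the first occurrence of x (length xs if absent)
  indexOf : List X → X → ℕ
  indexOf []       x = 0
  indexOf (y ∷ ys) x with y ≟ x
  ... | yes _ = 0
  ... | no  _ = suc (indexOf ys x)

  entryAt : List X → ℕ → X
  entryAt []       _       = default
  entryAt (y ∷ ys) zero    = y
  entryAt (y ∷ ys) (suc p) = entryAt ys p

  indexOf-< : ∀ {xs x} → x ∈ xs → indexOf xs x < length xs
  indexOf-< {y ∷ ys} {x} x∈ with y ≟ x
  ... | yes _ = s≤s z≤n
  indexOf-< {y ∷ ys} {x} (here refl) | no y≢x = ⊥-elim (y≢x refl)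
  indexOf-< {y ∷ ys} {x} (there x∈)  | no _   = s≤s (indexOf-< x∈)

  entryAt-indexOf : ∀ {xs x} → x ∈ xs → entryAt xs (indexOf xs x) ≡ x
  entryAt-indexOf {y ∷ ys} {x} x∈ with y ≟ x
  ... | yes y≡x = y≡x
  entryAt-indexOf {y ∷ ys} {x} (here refl) | no y≢x = ⊥-elim (y≢x refl)
  entryAt-indexOf {y ∷ ys} {x} (there x∈)  | no _   = entryAt-indexOf x∈

  -- Coding the members of a list D of length ≤ k by Fin (suc k), leaving
  -- the code k unused: code x is the position of x, decode reads it back.
  module Coding (D : List X) (k : ℕ) where

    code : X → Fin (suc k)
    code x = clamp k (indexOf D x)

    decode : Fin (suc k) → X
    decode c = entryAt D (toℕ c)

    code-correct : length D ≤ k → ∀ {x} → x ∈ D →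
                   (toℕ (code x) < k) × (decode (code x) ≡ x)
    code-correct |D|≤k {x} x∈D =
      subst (_< k) (sym toℕ-code) index<k ,
      trans (cong (entryAt D) toℕ-code) (entryAt-indexOf x∈D)
      where
      index<k : indexOf D x < k
      index<k = ≤-trans (indexOf-< x∈D) |D|≤k
      toℕ-code : toℕ (code x) ≡ indexOf D x
      toℕ-code = toℕ-clamp k _ (<⇒≤ index<k)

    code-injective : length D ≤ k → ∀ {x y} → x ∈ D → y ∈ D → code x ≡ code y → x ≡ y
    code-injective |D|≤k x∈D y∈D eq =
      trans (sym (proj₂ (code-correct |D|≤k x∈D)))
            (trans (cong decode eq) (proj₂ (code-correct |D|≤k y∈D)))

eqᵇ⇒≡ : ∀ {k} {a b : Fin k} → eqᵇ a b ≡ true → a ≡ b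
eqᵇ⇒≡ {a = a} {b} eq with a F.≟ b
... | yes a≡b = a≡b
eqᵇ⇒≡ () | no _

eqᵇ-refl : ∀ {k} (a : Fin k) → eqᵇ a a ≡ true
eqᵇ-refl a with a F.≟ a
... | yes _   = refl
... | no a≢a = ⊥-elim (a≢a refl)

eqᵇ-≢ : ∀ {k} {a b : Fin k} → a ≢ b → eqᵇ a b ≡ false
eqᵇ-≢ {a = a} {b} a≢b with a F.≟ b
... | yes a≡b = ⊥-elim (a≢b a≡b)
... | no _    = refl

eqᵇ-injective : ∀ {j k} (f : Fin j → Fin k) → (∀ {a b} → f a ≡ f b → a ≡ b) →
                ∀ a b → eqᵇ (f a) (f b) ≡ eqᵇ a b
eqᵇ-injective f f-injective a b with a F.≟ b
... | yes refl = eqᵇ-refl (f a)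
... | no a≢b  = eqᵇ-≢ (λ fa≡fb → a≢b (f-injective fa≡fb))

anyᶠ : ∀ {j} → (Fin j → Bool) → Bool
anyᶠ {zero}  P = false
anyᶠ {suc j} P = P zero ∨ anyᶠ (λ b → P (suc b))

anyᶠ-cong : ∀ {j} {P Q : Fin j → Bool} → (∀ b → P b ≡ Q b) → anyᶠ P ≡ anyᶠ Q
anyᶠ-cong {zero}  eq = refl
anyᶠ-cong {suc j} eq = cong₂ _∨_ (eq zero) (anyᶠ-cong (λ b → eq (suc b)))

anyᶠ-none : ∀ {j} (P : Fin j → Bool) → (∀ b → P b ≡ false) → anyᶠ P ≡ false
anyᶠ-none {zero}  P none = refl
anyᶠ-none {suc j} P none rewrite none zero = anyᶠ-none (λ b → P (suc b)) (λ b → none (suc b))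

anyᶠ-at : ∀ {j} (s : Fin j → Bool) (c : Fin j) → anyᶠ (λ b → s b ∧ eqᵇ c b) ≡ s c
anyᶠ-at {suc j} s zero
  rewrite anyᶠ-none (λ b → s (suc b) ∧ eqᵇ zero (suc b)) (λ b → ∧-zeroʳ (s (suc b))) =
  trans (∨-identityʳ _) (∧-identityʳ (s zero))
anyᶠ-at {suc j} s (suc c) rewrite ∧-zeroʳ (s zero) =
  trans (anyᶠ-cong (λ b → cong (s (suc b) ∧_) (eqᵇ-injective suc FP.suc-injective c b)))
        (anyᶠ-at (λ b → s (suc b)) c)

-- Layouts.  A permutation π puts vertex u at position π u (0-based), so
-- L(i) = {u : position u < i} and R(i) = {u : position u ≥ i}.

position : ∀ {m} → Permutation′ m → Fin m → ℕ
position π u = toℕ (π ⟨$⟩ʳ u)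

inL⇒< : ∀ {m} (π : Permutation′ m) {i u} → inL π i u ≡ true → position π u < i
inL⇒< π {i} {u} u∈L with s≤s p<i ← <ᵇ⇒< (suc (position π u)) (suc i) (Equivalence.from T-≡ u∈L) = p<i

<⇒inL : ∀ {m} (π : Permutation′ m) {i u} → position π u < i → inL π i u ≡ true
<⇒inL π p<i = Equivalence.to T-≡ (<⇒<ᵇ (s≤s p<i))

inR⇒≥ : ∀ {m} (π : Permutation′ m) {i u} → inR π i u ≡ true → i ≤ position π u
inR⇒≥ π {i} {u} u∈R = ≮⇒≥ λ p<i → not-both (<⇒inL π p<i) u∈R
  where
  not-both : ∀ {b} → b ≡ true → not b ≡ true → ⊥
  not-both refl ()

≥⇒inR : ∀ {m} (π : Permutation′ m) {i u} → i ≤ position π u → inR π i u ≡ true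
≥⇒inR π {i} {u} i≤p with inL π i u in u∈L
... | true  = ⊥-elim (<⇒≢ (≤-trans (inL⇒< π u∈L) i≤p) refl)
... | false = refl

∈Lset⇒inL : ∀ {m} (π : Permutation′ m) {i u} → u ∈ Lset π i → inL π i u ≡ true
∈Lset⇒inL {m} π {i} u∈ = proj₂ (∈-filter⁻ (λ u → inL π i u Bool.≟ true) {xs = allFin m} u∈)

inL⇒∈Lset : ∀ {m} (π : Permutation′ m) {i u} → inL π i u ≡ true → u ∈ Lset π i
inL⇒∈Lset π {i} {u} u∈L = ∈-filter⁺ (λ u → inL π i u Bool.≟ true) (∈-allFin u) u∈L

inR-suc : ∀ {m} (π : Permutation′ m) c {v} → inR π (suc c) v ≡ true → inR π c v ≡ true
inR-suc π c v∈R = ≥⇒inR π (≤-trans (n≤1+n c) (inR⇒≥ π {suc c} v∈R))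

reversed : ∀ {m} → Permutation′ m → Permutation′ m
reversed π = π ∘ₚ Perm.reverse

position-reversed : ∀ {m} (π : Permutation′ m) u →
                    position (reversed π) u ≡ m ∸ suc (position π u)
position-reversed π u = FP.opposite-prop (π ⟨$⟩ʳ u)

SameArcs : (G : Digraph) → (Fin (n G) → Bool) → Fin (n G) → Fin (n G) → Set
SameArcs G P u u' =
  ∀ v → P v ≡ true → (arc G u v ≡ arc G u' v) × (arc G v u ≡ arc G v u')

masked : ∀ {m} → (P a : Fin m → Bool) → Vec Bool m
masked P a = tabulate (λ v → P v ∧ a v)

agree⇒masked≡ : ∀ {m} {P a a' : Fin m → Bool} →
                (∀ v → P v ≡ true → a v ≡ a' v) → masked P a ≡ masked P a'
agree⇒masked≡ {P = P} {a} {a'} agree = VecP.tabulate-cong pointwise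
  where
  pointwise : ∀ v → (P v ∧ a v) ≡ (P v ∧ a' v)
  pointwise v with P v in Pv
  ... | false = refl
  ... | true  = agree v Pv

masked≡⇒agree : ∀ {m} {P a a' : Fin m → Bool} →
                masked P a ≡ masked P a' → ∀ v → P v ≡ true → a v ≡ a' v
masked≡⇒agree {P = P} {a} {a'} eq v Pv = subst (λ b → (b ∧ a v) ≡ (b ∧ a' v)) Pv entries
  where
  entries : (P v ∧ a v) ≡ (P v ∧ a' v)
  entries = trans (sym (VecP.lookup∘tabulate _ v))
                  (trans (cong (λ w → Vec.lookup w v) eq) (VecP.lookup∘tabulate _ v))

sameArcs⇒sameNbh : ∀ G π i {u u'} → SameArcs G (inR π i) u u' → Nbh G π i u ≡ Nbh G π i u'
sameArcs⇒sameNbh G π i same =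
  cong₂ _,_ (agree⇒masked≡ (λ v v∈R → proj₁ (same v v∈R)))
            (agree⇒masked≡ (λ v v∈R → proj₂ (same v v∈R)))

sameNbh⇒sameArcs : ∀ G π i {u u'} → Nbh G π i u ≡ Nbh G π i u' → SameArcs G (inR π i) u u'
sameNbh⇒sameArcs G π i {u} {u'} eq v v∈R =
  masked≡⇒agree {P = inR π i} {arc G u} {arc G u'} (cong proj₁ eq) v v∈R ,
  masked≡⇒agree {P = inR π i} {λ w → arc G w u} {λ w → arc G w u'} (cong proj₂ eq) v v∈R

encode : Bool → Bool → GF4
encode false false = 𝟘
encode true  false = ω
encode false true  = ω²
encode true  true  = 𝟙

entry≡encode : ∀ G x y → entry G x y ≡ encode (arc G x y) (arc G y x)
entry≡encode G x y with arc G x y | arc G y x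
... | false | false = refl
... | true  | false = refl
... | false | true  = refl
... | true  | true  = refl

outArc inArc : GF4 → Bool
outArc 𝟘  = false
outArc 𝟙  = true
outArc ω  = true
outArc ω² = false
inArc 𝟘  = false
inArc 𝟙  = true
inArc ω  = false
inArc ω² = true

outArc-encode : ∀ p q → outArc (encode p q) ≡ p
outArc-encode false false = refl
outArc-encode true  false = refl
outArc-encode false true  = refl
outArc-encode true  true  = refl

inArc-encode : ∀ p q → inArc (encode p q) ≡ q
inArc-encode false false = refl
inArc-encode true  false = refl
inArc-encode false true  = refl
inArc-encode true  true  = refl

sameArcs⇒agree : ∀ G {B u u'} → SameArcs G B u u' → Agree B (entry G) u u'
sameArcs⇒agree G {u = u} {u'} same y y∈B = begin
  entry G u y                           ≡⟨ entry≡encode G u y ⟩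
  encode (arc G u y)  (arc G y u)       ≡⟨ cong₂ encode (proj₁ (same y y∈B)) (proj₂ (same y y∈B)) ⟩
  encode (arc G u' y) (arc G y u')      ≡⟨ entry≡encode G u' y ⟨
  entry G u' y                          ∎
  where open ≡-Reasoning

agree⇒sameArcs : ∀ G {B u u'} → Agree B (entry G) u u' → SameArcs G B u u'
agree⇒sameArcs G {u = u} {u'} agree y y∈B =
  trans (sym (outArc-encode _ _)) (trans (cong outArc encoded) (outArc-encode _ _)) ,
  trans (sym (inArc-encode _ _))  (trans (cong inArc encoded)  (inArc-encode _ _))
  where
  encoded : encode (arc G u y) (arc G y u) ≡ encode (arc G u' y) (arc G y u')
  encoded = trans (sym (entry≡encode G u y)) (trans (agree y y∈B) (entry≡encode G u' y))

nbhList : (G : Digraph) → Permutation′ (n G) → ℕ → List (Vec Bool (n G) × Vec Bool (n G))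
nbhList G π i = deduplicate decNbh (map (Nbh G π i) (Lset π i))

nbhList⁺ : ∀ G π i {u} → inL π i u ≡ true → Nbh G π i u ∈ nbhList G π i
nbhList⁺ G π i u∈L = ∈-deduplicate⁺ decNbh (∈-map⁺ (Nbh G π i) (inL⇒∈Lset π {i} u∈L))

nbhList⁻ : ∀ G π i {N} → N ∈ nbhList G π i →
           Σ (Fin (n G)) λ u → (inL π i u ≡ true) × (N ≡ Nbh G π i u)
nbhList⁻ G π i N∈ with u , u∈ , N≡ ← ∈-map⁻ (Nbh G π i) (∈-deduplicate⁻ decNbh _ N∈) =
  u , ∈Lset⇒inL π {i} u∈ , N≡

nbhCount≤ : ∀ G π i {k} (h : Fin (n G) → Fin k) →
  (∀ {u u'} → inL π i u ≡ true → inL π i u' ≡ true → h u ≡ h u' →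
     SameArcs G (inR π i) u u') →
  nbhCount G π i ≤ k
nbhCount≤ G π i h separates =
  unique-length≤ (deduplicate-! decNbh _) (λ N∈ → h (vertex N∈)) identifies
  where
  vertex : ∀ {N} → N ∈ nbhList G π i → Fin (n G)
  vertex N∈ = proj₁ (nbhList⁻ G π i N∈)
  identifies : ∀ {N N'} (p : N ∈ nbhList G π i) (q : N' ∈ nbhList G π i) →
               h (vertex p) ≡ h (vertex q) → N ≡ N'
  identifies {N} {N'} p q eq =
    trans N≡ (trans (sameArcs⇒sameNbh G π i (separates u∈L u'∈L eq)) (sym N'≡))
    where
    u∈L : inL π i (vertex p) ≡ true
    u∈L = proj₁ (proj₂ (nbhList⁻ G π i p))
    N≡ : N ≡ Nbh G π i (vertex p)
    N≡ = proj₂ (proj₂ (nbhList⁻ G π i p))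
    u'∈L : inL π i (vertex q) ≡ true
    u'∈L = proj₁ (proj₂ (nbhList⁻ G π i q))
    N'≡ : N' ≡ Nbh G π i (vertex q)
    N'≡ = proj₂ (proj₂ (nbhList⁻ G π i q))

module NbhCode (G : Digraph) (π : Permutation′ (n G)) (i k : ℕ) =
  Positions.Coding decNbh (Vec.replicate _ false , Vec.replicate _ false) (nbhList G π i) k

-- d-lrw ≤ d-nw + 1.  Take the caterpillar whose leaf order is a layout
-- of width k.  Across a prefix cut the rows of L(i) fall into at most k
-- neighbourhood classes (coded in Fin (suc k)); a singleton cut has one row.

nw→lrw : ∀ G k → NWle G k → LRWle G (suc k)
nw→lrw G k (π , bound) = π , prefix , single
  where
  prefixClasses : ∀ i → Matrix.RowClasses (inL π i) (inR π i) (entry G) (suc k)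
  prefixClasses i with 1 ≤? i | i ≤? n G
  ... | yes 1≤i | yes i≤n = code , agree
    where
    open NbhCode G π i k using (code-injective) renaming (code to codeNbh)
    code : Fin (n G) → Fin (suc k)
    code u = codeNbh (Nbh G π i u)
    agree : ∀ u u' → inL π i u ≡ true → inL π i u' ≡ true → code u ≡ code u' →
            Agree (inR π i) (entry G) u u'
    agree u u' u∈L u'∈L eq = sameArcs⇒agree G (sameNbh⇒sameArcs G π i
      (code-injective (bound i 1≤i i≤n) (nbhList⁺ G π i u∈L) (nbhList⁺ G π i u'∈L) eq))
  ... | no i≱1 | _ =
    (λ _ → zero) , λ u _ u∈L → ⊥-elim (i≱1 (≤-trans (s≤s z≤n) (inL⇒< π u∈L)))
  ... | _ | no i≰n =
    (λ _ → zero) , λ _ _ _ _ _ y y∈R →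
      ⊥-elim (i≰n (≤-trans (inR⇒≥ π y∈R) (<⇒≤ (FP.toℕ<n (π ⟨$⟩ʳ y)))))
  prefix : ∀ i → RankLe G (inL π i) (inR π i) (suc k)
  prefix i = Matrix.classes⇒dependent (inL π i) (inR π i) (prefixClasses i)
  single : ∀ v → RankLe G (λ u → eqᵇ u v) (λ u → not (eqᵇ u v)) (suc k)
  single v = Matrix.classes⇒dependent (λ u → eqᵇ u v) (λ u → not (eqᵇ u v)) {entry G}
    ((λ _ → zero) , λ u u' u≡v u'≡v _ y _ →
      cong (λ w → entry G w y) (trans (eqᵇ⇒≡ u≡v) (sym (eqᵇ⇒≡ u'≡v))))

-- d-nw ≤ 4 ^ d-lrw.  Across a prefix cut of the leaf order the rows of
-- L(i) fall into 4^r classes of equal rows, and equal rows are equal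
-- neighbourhoods.

lrw→nw : ∀ G r → LRWle G r → NWle G (4 ^ r)
lrw→nw G r (σ , prefixRank , _) = σ , λ i _ _ → cut i
  where
  cut : ∀ i → nbhCount G σ i ≤ 4 ^ r
  cut i with h , agree ← Matrix.dependent⇒classes (inL σ i) (inR σ i) {entry G} r (prefixRank i) =
    nbhCount≤ G σ i h (λ u∈L u'∈L eq → agree⇒sameArcs G (agree _ _ u∈L u'∈L eq))

-- In a linear clique-width expression the vertex x : Fin m
-- was created toℕ x steps before the last one; the t latest vertices are
-- "young".  Old vertices carrying the same label when the young ones start
-- to be created can never be told apart by the young ones.

Twins : ∀ {k m} → LCW k m → ℕ → (Fin m → Fin k) → Set
Twins e t h = ∀ x x' → t ≤ toℕ x → t ≤ toℕ x' → h x ≡ h x' →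
  (lcwLab e x ≡ lcwLab e x') ×
  (∀ y → toℕ y < t → (lcwArc e x y ≡ lcwArc e x' y) × (lcwArc e y x ≡ lcwArc e y x'))

-- By induction on the expression, with h the labels at the moment the
-- young vertices start to be added.
twins : ∀ {k m} (e : LCW k m) (t : ℕ) → Σ (Fin m → Fin k) (Twins e t)
twins (vtx a) t = (λ _ → a) , λ _ _ _ _ _ → refl , λ _ _ → refl , refl
twins (add e a) zero = lcwLab (add e a) , λ _ _ _ _ same → same , λ _ ()
twins {k} {suc m} (add e a) (suc t) with h , twin ← twins e t = h' , twin'
  where
  h' : Fin (suc m) → Fin k
  h' zero    = a
  h' (suc x) = h x
  twin' : Twins (add e a) (suc t) h'
  twin' (suc x) (suc x') (s≤s old) (s≤s old') same
    with sameLabel , sameArcs ← twin x x' old old' same = sameLabel , young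
    where
    young : ∀ y → toℕ y < suc t →
            (lcwArc (add e a) (suc x) y ≡ lcwArc (add e a) (suc x') y) ×
            (lcwArc (add e a) y (suc x) ≡ lcwArc (add e a) y (suc x'))
    young zero    _           = refl , refl
    young (suc y) (s≤s young) = sameArcs y young
twins (α e a b a≢b) t with h , twin ← twins e t = h , twin'
  where
  twin' : Twins (α e a b a≢b) t h
  twin' x x' old old' same with sameLabel , sameArcs ← twin x x' old old' same =
    sameLabel , young
    where
    young : ∀ y → toℕ y < t →
            (lcwArc (α e a b a≢b) x y ≡ lcwArc (α e a b a≢b) x' y) ×
            (lcwArc (α e a b a≢b) y x ≡ lcwArc (α e a b a≢b) y x')
    young y young-y rewrite sameLabel | proj₁ (sameArcs y young-y) | proj₂ (sameArcs y young-y) =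
      refl , refl
twins (ρ e a b) t with h , twin ← twins e t = h , twin'
  where
  twin' : Twins (ρ e a b) t h
  twin' x x' old old' same with sameLabel , sameArcs ← twin x x' old old' same =
    cong (λ l → if eqᵇ l a then b else l) sameLabel , sameArcs

reversed-young : ∀ {m i q} → q < m → i ≤ m ∸ suc q → q < m ∸ i
reversed-young {m} {i} {q} q<m i≤ =
  m+n≤o⇒m≤o∸n (suc q) (subst (_≤ m) (+-comm i (suc q)) (m≤o∸n⇒m+n≤o i q<m i≤))

reversed-old : ∀ {m i q} → m ∸ suc q < i → m ∸ i ≤ q
reversed-old {m} {i} {q} <i = ≮⇒≥ λ q<t → <⇒≱ <i (young⇒reversed q<t)
  where
  young⇒reversed : q < m ∸ i → i ≤ m ∸ suc q
  young⇒reversed q<t =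
    m+n≤o⇒m≤o∸n i (subst (_≤ m) (+-comm (suc q) i)
      (m≤o∸n⇒m+n≤o (suc q) (<⇒≤ (m∸n≢0⇒n<m λ t≡0 → <⇒≱ q<t (subst (_≤ q) (sym t≡0) z≤n))) q<t))

-- Lay the vertices out in creation order (the reverse of the numbering
-- of the expression); then L(i) consists of old vertices for t = m ∸ i,
-- and R(i) of young ones.
lcw→nw : ∀ G k → LCWle G k → NWle G k
lcw→nw G k (e , π , iso) = τ , λ i _ _ → nbhCount≤ G τ i (h i) (separates i)
  where
  τ : Permutation′ (n G)
  τ = reversed π
  h : ℕ → Fin (n G) → Fin k
  h i u = proj₁ (twins e (n G ∸ i)) (π ⟨$⟩ʳ u)
  old : ∀ {i u} → inL τ i u ≡ true → n G ∸ i ≤ position π u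
  old {i} {u} u∈L = reversed-old (subst (_< i) (position-reversed π u) (inL⇒< τ u∈L))
  young : ∀ {i v} → inR τ i v ≡ true → position π v < n G ∸ i
  young {i} {v} v∈R =
    reversed-young (FP.toℕ<n (π ⟨$⟩ʳ v)) (subst (i ≤_) (position-reversed π v) (inR⇒≥ τ v∈R))
  separates : ∀ i {u u'} → inL τ i u ≡ true → inL τ i u' ≡ true → h i u ≡ h i u' →
              SameArcs G (inR τ i) u u'
  separates i {u} {u'} u∈L u'∈L same v v∈R =
    trans (iso u v) (trans (proj₁ arcs) (sym (iso u' v))) ,
    trans (iso v u) (trans (proj₂ arcs) (sym (iso v u')))
    where
    x x' y : Fin (n G)
    x  = π ⟨$⟩ʳ u
    x' = π ⟨$⟩ʳ u'
    y  = π ⟨$⟩ʳ v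
    arcs : (lcwArc e x y ≡ lcwArc e x' y) × (lcwArc e y x ≡ lcwArc e y x')
    arcs = proj₂ (proj₂ (twins e (n G ∸ i)) x x' (old {i} u∈L) (old {i} u'∈L) same) y (young {i} v∈R)

-- d-lcw ≤ 2·d-lnlcw + 1.  An NLC expression with labels Fin k is
-- simulated by a clique-width expression with labels
--   live a  (a : Fin k),   spare a  (a : Fin k),   fresh.
-- A vertex with label a is simulated by a vertex with label live a.  The
-- insertion ⊗ is a fresh vertex followed by one α per label b with
-- (b , a) ∈ S→ or S←, and then fresh ↦ live a; a relabelling R
-- is performed as live c ↦ spare (R c) followed by spare c ↦ live c.

module Simulation (k : ℕ) where

  K : ℕ
  K = suc (k + k)

  live spare : Fin k → Fin K
  live  a = F.inject₁ (a F.↑ˡ k)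
  spare a = F.inject₁ (k F.↑ʳ a)

  fresh : Fin K
  fresh = F.fromℕ (k + k)

  live-injective : ∀ {a b} → live a ≡ live b → a ≡ b
  live-injective eq = FP.↑ˡ-injective k _ _ (FP.inject₁-injective eq)

  spare-injective : ∀ {a b} → spare a ≡ spare b → a ≡ b
  spare-injective eq = FP.↑ʳ-injective k _ _ (FP.inject₁-injective eq)

  live≢fresh : ∀ a → live a ≢ fresh
  live≢fresh a eq = FP.fromℕ≢inject₁ (sym eq)

  spare≢fresh : ∀ a → spare a ≢ fresh
  spare≢fresh a eq = FP.fromℕ≢inject₁ (sym eq)

  live≢spare : ∀ a b → live a ≢ spare b
  live≢spare a b eq = <⇒≢ live<k (trans (cong toℕ eq) toℕ-spare)
    where
    toℕ-spare : toℕ (spare b) ≡ k + toℕ b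
    toℕ-spare = trans (FP.toℕ-inject₁ _) (FP.toℕ-↑ʳ k b)
    live<k : toℕ (live a) < k + toℕ b
    live<k = subst (_< k + toℕ b) (sym (trans (FP.toℕ-inject₁ _) (FP.toℕ-↑ˡ a k)))
                   (≤-trans (FP.toℕ<n a) (m≤m+n k (toℕ b)))

  α? : ∀ {m} → Bool → LCW K m → (a b : Fin K) → a ≢ b → LCW K m
  α? true  e a b a≢b = α e a b a≢b
  α? false e a b a≢b = e

  α?-lab : ∀ {m} s (e : LCW K m) a b (a≢b : a ≢ b) x → lcwLab (α? s e a b a≢b) x ≡ lcwLab e x
  α?-lab true  e a b a≢b x = refl
  α?-lab false e a b a≢b x = refl

  α?-arc : ∀ {m} s (e : LCW K m) a b (a≢b : a ≢ b) x y →
    lcwArc (α? s e a b a≢b) x y ≡ lcwArc e x y ∨ (s ∧ (eqᵇ (lcwLab e x) a ∧ eqᵇ (lcwLab e y) b))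
  α?-arc true  e a b a≢b x y = refl
  α?-arc false e a b a≢b x y = sym (∨-identityʳ _)

  αChain : ∀ {m j} → LCW K m → (s : Fin j → Bool) (src tgt : Fin j → Fin K) →
           (∀ b → src b ≢ tgt b) → LCW K m
  αChain {j = zero}  e s src tgt src≢tgt = e
  αChain {j = suc j} e s src tgt src≢tgt =
    αChain (α? (s zero) e (src zero) (tgt zero) (src≢tgt zero))
           (λ b → s (suc b)) (λ b → src (suc b)) (λ b → tgt (suc b)) (λ b → src≢tgt (suc b))

  αChain-lab : ∀ {m j} (e : LCW K m) (s : Fin j → Bool) src tgt src≢tgt x →
               lcwLab (αChain e s src tgt src≢tgt) x ≡ lcwLab e x
  αChain-lab {j = zero}  e s src tgt src≢tgt x = refl
  αChain-lab {j = suc j} e s src tgt src≢tgt x =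
    trans (αChain-lab (α? (s zero) e (src zero) (tgt zero) (src≢tgt zero))
                      (λ b → s (suc b)) (λ b → src (suc b)) (λ b → tgt (suc b))
                      (λ b → src≢tgt (suc b)) x)
          (α?-lab (s zero) e _ _ (src≢tgt zero) x)

  αChain-arc : ∀ {m j} (e : LCW K m) (s : Fin j → Bool) src tgt src≢tgt x y →
    lcwArc (αChain e s src tgt src≢tgt) x y
      ≡ lcwArc e x y ∨ anyᶠ (λ b → s b ∧ (eqᵇ (lcwLab e x) (src b) ∧ eqᵇ (lcwLab e y) (tgt b)))
  αChain-arc {j = zero}  e s src tgt src≢tgt x y = sym (∨-identityʳ _)
  αChain-arc {m} {suc j} e s src tgt src≢tgt x y = begin
    lcwArc (αChain e′ (λ b → s (suc b)) (λ b → src (suc b)) (λ b → tgt (suc b))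
                      (λ b → src≢tgt (suc b))) x y
      ≡⟨ αChain-arc e′ (λ b → s (suc b)) (λ b → src (suc b)) (λ b → tgt (suc b))
                       (λ b → src≢tgt (suc b)) x y ⟩
    lcwArc e′ x y ∨ anyᶠ (λ b → s (suc b) ∧ (eqᵇ (lcwLab e′ x) (src (suc b)) ∧
                                             eqᵇ (lcwLab e′ y) (tgt (suc b))))
      ≡⟨ cong₂ _∨_ (α?-arc (s zero) e _ _ (src≢tgt zero) x y)
                   (cong₂ (λ lx ly → anyᶠ (λ b → s (suc b) ∧ (eqᵇ lx (src (suc b)) ∧
                                                              eqᵇ ly (tgt (suc b)))))
                          (α?-lab (s zero) e _ _ (src≢tgt zero) x)
                          (α?-lab (s zero) e _ _ (src≢tgt zero) y)) ⟩
    (lcwArc e x y ∨ P zero) ∨ anyᶠ (λ b → P (suc b))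
      ≡⟨ ∨-assoc (lcwArc e x y) (P zero) _ ⟩
    lcwArc e x y ∨ anyᶠ P ∎
    where
    open ≡-Reasoning
    e′ : LCW K m
    e′ = α? (s zero) e (src zero) (tgt zero) (src≢tgt zero)
    P : Fin (suc j) → Bool
    P b = s b ∧ (eqᵇ (lcwLab e x) (src b) ∧ eqᵇ (lcwLab e y) (tgt b))

  ρ-miss : ∀ {m} (e : LCW K m) a b x → lcwLab e x ≢ a → lcwLab (ρ e a b) x ≡ lcwLab e x
  ρ-miss e a b x ≢a = cong (λ t → if t then b else lcwLab e x) (eqᵇ-≢ ≢a)

  ρ-hit : ∀ {m} (e : LCW K m) a b x → lcwLab e x ≡ a → lcwLab (ρ e a b) x ≡ b
  ρ-hit e a b x refl = cong (λ t → if t then b else lcwLab e x) (eqᵇ-refl (lcwLab e x))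

  ρChain : ∀ {m j} → LCW K m → (src tgt : Fin j → Fin K) → LCW K m
  ρChain {j = zero}  e src tgt = e
  ρChain {j = suc j} e src tgt =
    ρChain (ρ e (src zero) (tgt zero)) (λ b → src (suc b)) (λ b → tgt (suc b))

  ρChain-arc : ∀ {m j} (e : LCW K m) (src tgt : Fin j → Fin K) x y →
               lcwArc (ρChain e src tgt) x y ≡ lcwArc e x y
  ρChain-arc {j = zero}  e src tgt x y = refl
  ρChain-arc {j = suc j} e src tgt x y =
    ρChain-arc (ρ e (src zero) (tgt zero)) (λ b → src (suc b)) (λ b → tgt (suc b)) x y

  ρChain-miss : ∀ {m j} (e : LCW K m) (src tgt : Fin j → Fin K) x →
                (∀ b → lcwLab e x ≢ src b) → lcwLab (ρChain e src tgt) x ≡ lcwLab e x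
  ρChain-miss {j = zero}  e src tgt x miss = refl
  ρChain-miss {j = suc j} e src tgt x miss =
    trans (ρChain-miss (ρ e (src zero) (tgt zero)) (λ b → src (suc b)) (λ b → tgt (suc b)) x
                       (λ b eq → miss (suc b) (trans (sym unchanged) eq)))
          unchanged
    where
    unchanged : lcwLab (ρ e (src zero) (tgt zero)) x ≡ lcwLab e x
    unchanged = ρ-miss e _ _ x (miss zero)

  ρChain-hit : ∀ {m j} (e : LCW K m) (src tgt : Fin j → Fin K) x c →
               (∀ {b b'} → src b ≡ src b' → b ≡ b') → (∀ b b' → tgt b ≢ src b') →
               lcwLab e x ≡ src c → lcwLab (ρChain e src tgt) x ≡ tgt c
  ρChain-hit {j = suc j} e src tgt x zero src-injective disjoint hit =
    trans (ρChain-miss (ρ e (src zero) (tgt zero)) (λ b → src (suc b)) (λ b → tgt (suc b)) x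
                       (λ b eq → disjoint zero (suc b) (trans (sym moved) eq)))
          moved
    where
    moved : lcwLab (ρ e (src zero) (tgt zero)) x ≡ tgt zero
    moved = ρ-hit e _ _ x hit
  ρChain-hit {j = suc j} e src tgt x (suc c) src-injective disjoint hit =
    ρChain-hit (ρ e (src zero) (tgt zero)) (λ b → src (suc b)) (λ b → tgt (suc b)) x c (λ eq → FP.suc-injective (src-injective eq))
               (λ b b' → disjoint (suc b) (suc b')) (trans unchanged hit)
    where
    unchanged : lcwLab (ρ e (src zero) (tgt zero)) x ≡ lcwLab e x
    unchanged = ρ-miss e _ _ x (λ eq → 0≢1+n (src-injective (trans (sym eq) hit)))
      where
      0≢1+n : ∀ {j} {b : Fin j} → Fin.zero ≢ suc b
      0≢1+n ()

  insert : ∀ {m} → LCW K m → (Sout Sin : Fin k → Fin k → Bool) → Fin k → LCW K (suc m)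
  insert e Sout Sin a =
    αChain (αChain (add e fresh) (λ b → Sout b a) live (λ _ → fresh) live≢fresh)
           (λ b → Sin b a) (λ _ → fresh) live (λ b eq → live≢fresh b (sym eq))

  simulate : ∀ {m} → NLC k m → LCW K m
  simulate (vtx a)             = vtx (live a)
  simulate (add e Sout Sin a)  = ρ (insert (simulate e) Sout Sin a) fresh (live a)
  simulate (rel e R)           =
    ρChain (ρChain (simulate e) live (λ c → spare (R c))) spare live

  insert-lab : ∀ {m} (e : LCW K m) Sout Sin a x →
               lcwLab (insert e Sout Sin a) x ≡ lcwLab (add e fresh) x
  insert-lab e Sout Sin a x =
    trans (αChain-lab _ (λ b → Sin b a) (λ _ → fresh) live _ x)
          (αChain-lab (add e fresh) (λ b → Sout b a) live (λ _ → fresh) live≢fresh x)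

  simulate-lab : ∀ {m} (e : NLC k m) x → lcwLab (simulate e) x ≡ live (nlcLab e x)
  simulate-lab (vtx a) zero = refl
  simulate-lab (add e Sout Sin a) x
    rewrite insert-lab (simulate e) Sout Sin a x = relabel x
    where
    relabel : ∀ x → (if eqᵇ (lcwLab (add (simulate e) fresh) x) fresh
                      then live a else lcwLab (add (simulate e) fresh) x)
                    ≡ live (nlcLab (add e Sout Sin a) x)
    relabel zero    rewrite eqᵇ-refl fresh = refl
    relabel (suc x) rewrite simulate-lab e x | eqᵇ-≢ (live≢fresh (nlcLab e x)) = refl
  simulate-lab (rel e R) x =
    ρChain-hit _ spare live x (R (nlcLab e x)) spare-injective (λ b b' → live≢spare b b')
      (ρChain-hit (simulate e) live (λ c → spare (R c)) x (nlcLab e x) live-injective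
                  (λ b b' eq → live≢spare b' (R b) (sym eq)) (simulate-lab e x))

  simulate-arc : ∀ {m} (e : NLC k m) x y → lcwArc (simulate e) x y ≡ nlcArc e x y
  simulate-arc (vtx a) x y = refl
  simulate-arc {suc m} (add e Sout Sin a) x y =
    trans (αChain-arc e₁ (λ b → Sin b a) (λ _ → fresh) live _ x y)
          (trans (cong₂ (λ A lx → A ∨ incoming lx (lcwLab e₁ y))
                        (αChain-arc e₀ (λ b → Sout b a) live (λ _ → fresh) live≢fresh x y)
                        (lab₁ x))
                 (trans (cong (λ ly → (lcwArc e₀ x y ∨ outgoing (lcwLab e₀ x) (lcwLab e₀ y)) ∨
                                      incoming (lcwLab e₀ x) ly) (lab₁ y))
                        (cases x y)))
    where
    e₀ : LCW K (suc m)
    e₀ = add (simulate e) fresh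
    e₁ : LCW K (suc m)
    e₁ = αChain e₀ (λ b → Sout b a) live (λ _ → fresh) live≢fresh
    lab₁ : ∀ x → lcwLab e₁ x ≡ lcwLab e₀ x
    lab₁ = αChain-lab e₀ (λ b → Sout b a) live (λ _ → fresh) live≢fresh
    outgoing incoming : Fin K → Fin K → Bool
    outgoing lx ly = anyᶠ (λ b → Sout b a ∧ (eqᵇ lx (live b) ∧ eqᵇ ly fresh))
    incoming lx ly = anyᶠ (λ b → Sin b a ∧ (eqᵇ lx fresh ∧ eqᵇ ly (live b)))
    live-out : ∀ c → outgoing (live c) fresh ≡ Sout c a
    live-out c rewrite eqᵇ-refl fresh =
      trans (anyᶠ-cong (λ b → cong (Sout b a ∧_)
                          (trans (∧-identityʳ _) (eqᵇ-injective live live-injective c b))))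
            (anyᶠ-at (λ b → Sout b a) c)
    live-in : ∀ c → incoming fresh (live c) ≡ Sin c a
    live-in c rewrite eqᵇ-refl fresh =
      trans (anyᶠ-cong (λ b → cong (Sin b a ∧_) (eqᵇ-injective live live-injective c b)))
            (anyᶠ-at (λ b → Sin b a) c)
    no-out : ∀ lx c → outgoing lx (live c) ≡ false
    no-out lx c = anyᶠ-none _ λ b →
      trans (cong (λ t → Sout b a ∧ (eqᵇ lx (live b) ∧ t)) (eqᵇ-≢ (live≢fresh c)))
            (trans (cong (Sout b a ∧_) (∧-zeroʳ _)) (∧-zeroʳ _))
    no-out-fresh : outgoing fresh fresh ≡ false
    no-out-fresh = anyᶠ-none _ λ b →
      trans (cong (λ t → Sout b a ∧ (t ∧ eqᵇ fresh fresh))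
                  (eqᵇ-≢ (λ eq → live≢fresh b (sym eq)))) (∧-zeroʳ _)
    no-in : ∀ c ly → incoming (live c) ly ≡ false
    no-in c ly = anyᶠ-none _ λ b →
      trans (cong (λ t → Sin b a ∧ (t ∧ eqᵇ ly (live b))) (eqᵇ-≢ (live≢fresh c))) (∧-zeroʳ _)
    no-in-fresh : incoming fresh fresh ≡ false
    no-in-fresh = anyᶠ-none _ λ b →
      trans (cong (λ t → Sin b a ∧ (eqᵇ fresh fresh ∧ t))
                  (eqᵇ-≢ (λ eq → live≢fresh b (sym eq))))
            (trans (cong (Sin b a ∧_) (∧-zeroʳ _)) (∧-zeroʳ _))
    cases : ∀ x y → (lcwArc e₀ x y ∨ outgoing (lcwLab e₀ x) (lcwLab e₀ y)) ∨
                    incoming (lcwLab e₀ x) (lcwLab e₀ y)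
                    ≡ nlcArc (add e Sout Sin a) x y
    cases zero    zero    rewrite no-out-fresh | no-in-fresh = refl
    cases (suc x) zero    rewrite simulate-lab e x | live-out (nlcLab e x)
                                | no-in (nlcLab e x) fresh = ∨-identityʳ _
    cases zero    (suc y) rewrite simulate-lab e y | no-out fresh (nlcLab e y)
                                | live-in (nlcLab e y) = refl
    cases (suc x) (suc y) rewrite simulate-lab e x | simulate-lab e y
                                | no-out (live (nlcLab e x)) (nlcLab e y)
                                | no-in (nlcLab e x) (live (nlcLab e y))
                                | simulate-arc e x y =
      trans (∨-identityʳ _) (∨-identityʳ _)
  simulate-arc (rel e R) x y =
    trans (ρChain-arc _ spare live x y)
          (trans (ρChain-arc (simulate e) live (λ c → spare (R c)) x y) (simulate-arc e x y))

nlc→lcw : ∀ G k → LNLCle G k → LCWle G (suc (k + k))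
nlc→lcw G k (e , π , iso) =
  simulate e , π , λ u v → trans (iso u v) (sym (simulate-arc e _ _))
  where open Simulation k

-- d-lnlcw ≤ d-nw + 1.  Insert the vertices in layout order w 0, w 1, ….
-- Invariant: after inserting w 0 … w i, each vertex u is labelled by the
-- code of its neighbourhood N_{i+1}(u) across the cut behind w i; the
-- code k is kept free for the vertex being inserted.  The next vertex
-- w (i+1) is joined to each label class as the decoded neighbourhood
-- prescribes, and each class is then relabelled to the code of its
-- neighbourhood across the next cut.

module LayoutExpression
  (n' : ℕ) (ar : Fin (suc n') → Fin (suc n') → Bool) (ir : ∀ u → ar u u ≡ false)
  (k : ℕ) (π : Permutation′ (suc n')) where

  G : Digraph
  G = record { n = suc n' ; arc = ar ; irrefl = ir }

  -- the vertex at position p (positions beyond n' are clamped)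
  w : ℕ → Fin (suc n')
  w p = π ⟨$⟩ˡ clamp n' p

  position-w : ∀ {p} → p ≤ n' → position π (w p) ≡ p
  position-w p≤n' = trans (cong toℕ (inverseʳ π)) (toℕ-clamp n' _ p≤n')

  module Code (c : ℕ) = NbhCode G π c k

  label : ℕ → Fin (suc n') → Fin (suc k)
  label c u = Code.code c (Nbh G π c u)

  fresh : Fin (suc k)
  fresh = F.fromℕ k

  restrict : ℕ → Vec Bool (suc n') × Vec Bool (suc n') → Vec Bool (suc n') × Vec Bool (suc n')
  restrict c (out , in′) = masked (inR π c) (Vec.lookup out) , masked (inR π c) (Vec.lookup in′)

  restrict-Nbh : ∀ c u → restrict (suc c) (Nbh G π c u) ≡ Nbh G π (suc c) u
  restrict-Nbh c u = cong₂ _,_ (agree⇒masked≡ (shrink (ar u))) (agree⇒masked≡ (shrink (λ v → ar v u)))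
    where
    shrink : ∀ (a : Fin (suc n') → Bool) v → inR π (suc c) v ≡ true →
             Vec.lookup (masked (inR π c) a) v ≡ a v
    shrink a v v∈R rewrite VecP.lookup∘tabulate (λ v → inR π c v ∧ a v) v
                         | inR-suc π c v∈R = refl

  Sout Sin : ℕ → Fin (suc k) → Fin (suc k) → Bool
  Sout i b _ = Vec.lookup (proj₁ (Code.decode (suc i) b)) (w (suc i))
  Sin  i b _ = Vec.lookup (proj₂ (Code.decode (suc i) b)) (w (suc i))

  relabel : ℕ → Fin (suc k) → Fin (suc k)
  relabel i b = if eqᵇ b fresh then label (suc (suc i)) (w (suc i))
                else Code.code (suc (suc i)) (restrict (suc (suc i)) (Code.decode (suc i) b))

  expr : (i : ℕ) → NLC (suc k) (suc i)
  expr zero    = vtx (label 1 (w 0))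
  expr (suc i) = rel (add (expr i) (Sout i) (Sin i) fresh) (relabel i)

  W : (i : ℕ) → Fin (suc i) → Fin (suc n')
  W i x = w (i ∸ toℕ x)

  inL-W : ∀ {i} (x : Fin (suc i)) → i ≤ n' → inL π (suc i) (W i x) ≡ true
  inL-W {i} x i≤n' = <⇒inL π (subst (_< suc i) (sym (position-w (≤-trans (m∸n≤m i (toℕ x)) i≤n')))
                                     (s≤s (m∸n≤m i (toℕ x))))

  inR-next : ∀ {i} → suc i ≤ n' → inR π (suc i) (w (suc i)) ≡ true
  inR-next i<n' = ≥⇒inR π (≤-reflexive (sym (position-w i<n')))

  module Width (bound : ∀ i → 1 ≤ i → i ≤ suc n' → nbhCount G π i ≤ k) where

    label-correct : ∀ {c u} → 1 ≤ c → c ≤ suc n' → inL π c u ≡ true →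
                    (label c u ≢ fresh) × (Code.decode c (label c u) ≡ Nbh G π c u)
    label-correct {c} {u} 1≤c c≤n u∈L with <k , decoded ← Code.code-correct c (bound c 1≤c c≤n) (nbhList⁺ G π c u∈L) =
      (λ eq → <⇒≢ <k (trans (cong toℕ eq) (FP.toℕ-fromℕ k))) , decoded

    Invariant : ℕ → Set
    Invariant i = (∀ x → nlcLab (expr i) x ≡ label (suc i) (W i x)) ×
                  (∀ x y → nlcArc (expr i) x y ≡ ar (W i x) (W i y))

    invariant : ∀ i → i ≤ n' → Invariant i
    invariant zero    _     = (λ { zero → refl }) , (λ { zero zero → sym (ir (w 0)) })
    invariant (suc i) i<n' = labels , arcs
      where
      IH : Invariant i
      IH = invariant i (≤-trans (n≤1+n i) i<n')
      old-label : ∀ x → (label (suc i) (W i x) ≢ fresh) ×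
                        (Code.decode (suc i) (label (suc i) (W i x)) ≡ Nbh G π (suc i) (W i x))
      old-label x = label-correct (s≤s z≤n) (s≤s (≤-trans (n≤1+n i) i<n'))
                                  (inL-W x (≤-trans (n≤1+n i) i<n'))
      labels : ∀ x → nlcLab (expr (suc i)) x ≡ label (suc (suc i)) (W (suc i) x)
      labels zero rewrite eqᵇ-refl fresh = refl
      labels (suc x) rewrite proj₁ IH x | eqᵇ-≢ (proj₁ (old-label x)) | proj₂ (old-label x)
                           | restrict-Nbh (suc i) (W i x) = refl
      arcs : ∀ x y → nlcArc (expr (suc i)) x y ≡ ar (W (suc i) x) (W (suc i) y)
      arcs zero    zero    = sym (ir (w (suc i)))
      arcs (suc x) zero    rewrite proj₁ IH x | proj₂ (old-label x)
                                 | VecP.lookup∘tabulate (λ v → inR π (suc i) v ∧ ar (W i x) v) (w (suc i))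
                                 | inR-next i<n' = refl
      arcs zero    (suc y) rewrite proj₁ IH y | proj₂ (old-label y)
                                 | VecP.lookup∘tabulate (λ v → inR π (suc i) v ∧ ar v (W i y)) (w (suc i))
                                 | inR-next i<n' = refl
      arcs (suc x) (suc y) = proj₂ IH x y

    -- the last vertex x of expr n' is the vertex at position n' ∸ x, i.e.
    -- the expression's numbering is the reversed layout
    numbering : ∀ u → W n' (reversed π ⟨$⟩ʳ u) ≡ u
    numbering u = trans (cong w n'∸reversed) (trans (cong (π ⟨$⟩ˡ_) clamp-position) (inverseˡ π))
      where
      p<n : position π u < suc n'
      p<n = FP.toℕ<n (π ⟨$⟩ʳ u)
      n'∸reversed : n' ∸ position (reversed π) u ≡ position π u
      n'∸reversed = trans (cong (n' ∸_) (position-reversed π u)) (m∸[m∸n]≡n (≤-pred p<n))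
      clamp-position : clamp n' (position π u) ≡ π ⟨$⟩ʳ u
      clamp-position = FP.toℕ-injective (toℕ-clamp n' _ (≤-pred p<n))

    result : LNLCle G (suc k)
    result = expr n' , reversed π ,
             λ u v → sym (trans (proj₂ (invariant n' ≤-refl) _ _) (cong₂ ar (numbering u) (numbering v)))

nw→nlc : ∀ G k → 0 < n G → NWle G k → LNLCle G (suc k)
nw→nlc record { n = suc n' ; arc = ar ; irrefl = ir } k _ (π , bound) =
  LayoutExpression.Width.result n' ar ir k π bound

nlc-nonempty : ∀ {k m} → NLC k m → 0 < m
nlc-nonempty (vtx _)         = s≤s z≤n
nlc-nonempty (add _ _ _ _)   = s≤s z≤n
nlc-nonempty (rel e _)       = nlc-nonempty e

lcw-nonempty : ∀ {k m} → LCW k m → 0 < m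
lcw-nonempty (vtx _)       = s≤s z≤n
lcw-nonempty (add _ _)     = s≤s z≤n
lcw-nonempty (α e _ _ _)   = lcw-nonempty e
lcw-nonempty (ρ e _ _)     = lcw-nonempty e

nw-bound : Param → ℕ → ℕ
nw-bound d-nw    k = k
nw-bound d-lnlcw k = suc (k + k)
nw-bound d-lcw   k = k
nw-bound d-lrw   k = 4 ^ k

to-nw : ∀ p G k → WidthLe p G k → NWle G (nw-bound p k)
to-nw d-nw    G k w = w
to-nw d-lnlcw G k w = lcw→nw G (suc (k + k)) (nlc→lcw G k w)
to-nw d-lcw   G k w = lcw→nw G k w
to-nw d-lrw   G k w = lrw→nw G k w

-- p ≤ param-bound p k  whenever  d-nw ≤ k  (and G has a p-decomposition at all)
param-bound : Param → ℕ → ℕ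
param-bound d-nw    k = k
param-bound d-lnlcw k = suc k
param-bound d-lcw   k = suc (suc k + suc k)
param-bound d-lrw   k = suc k

from-nw : ∀ p G {j} k → WidthLe p G j → NWle G k → WidthLe p G (param-bound p k)
from-nw d-nw    G k _       w = w
from-nw d-lnlcw G k (e , _) w = nw→nlc G k (nlc-nonempty e) w
from-nw d-lcw   G k (e , _) w = nlc→lcw G (suc k) (nw→nlc G k (lcw-nonempty e) w)
from-nw d-lrw   G k _       w = nw→lrw G k w

theorem5p5 : (α β : Param) →
    Σ (ℕ → ℕ) λ f₁ → Σ (ℕ → ℕ) λ f₂ →
      ∀ (G : Digraph) (a b : ℕ) → WidthIs α G a → WidthIs β G b →
        (a ≤ f₁ b) × (b ≤ f₂ a)
theorem5p5 p q =
  (λ b → param-bound p (nw-bound q b)) , (λ a → param-bound q (nw-bound p a)) ,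
  λ G a b (p≤a , a-least) (q≤b , b-least) →
    a-least _ (from-nw p G _ p≤a (to-nw q G b q≤b)) ,
    b-least _ (from-nw q G _ q≤b (to-nw p G a p≤a))
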